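{- Let $1\le k\le n$ be integers and $\pi\in\mathcal{S}_n$. If $\pi\notin\mathcal{S}_n^k$, then $\mathrm{IPF}_k(n,\pi)=0$. Otherwise, \[\mathrm{IPF}_k(n,\pi)=\prod_{i=1}^{n-k}\min\{a_i(\pi),k\}\cdot\prod_{i=n-k+1}^{n}\min\{n-i-k+a_i(\pi)+1,\;n-i+1\}.\]
   Context: Let $[n]=\{1,\dots,n\}$, $\mathcal{S}_n$ the permutations of $[n]$ in one-line notation, and $\pi_i^{ -1}$ the position $j$ with $\pi_j=i$. A tuple $(C_1,\dots,C_n)$ of non-empty subsets of $[n]$ is a subset parking function with outcome $\pi$ if for every $1\le i\le n$, $\pi_i^{ -1}$ is the smallest element of $C_i\setminus\{\pi_{i'}^{ -1}:i'<i\}$. A $k$-interval parking function is such a tuple in which every $C_i$ is an interval $\{a,\dots,a+k-1\}\subseteq[n]$ with exactly $k$ elements; $\mathrm{IPF}_k(n,\pi)$ counts those with outcome $\pi$. $\mathcal{S}_n^k$ is the set of $\pi\in\mathcal{S}_n$ with $\pi_n>\pi_{n-1}>\cdots>\pi_{n-k+1}$. For $1\le i\le n$, $a_i(\pi)$ is the largest $j$ with $1\le j\le i$ such that $\pi_i\ge\pi_{i'}$ for all $i-j+1\le i'\le i$. -}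

module Defs where

open import Data.Nat using (ℕ; zero; suc; _+_; _*_; _∸_; _≤_; _<_; _≤?_; _<?_; _⊔_; _⊓_; _≤ᵇ_; _<ᵇ_)
open import Data.Bool using (Bool; true; false; _∧_)
open import Data.Fin using (Fin; toℕ)
open import Data.Fin.Properties using (all?; any?)
open import Data.Fin.Subset using (Subset; _∈_; _∉_)
open import Data.Fin.Subset.Properties using (_∈?_)
open import Data.Fin.Permutation using (Permutation′; _⟨$⟩ʳ_; _⟨$⟩ˡ_)
open import Data.Vec using (Vec; []; _∷_; tabulate; lookup; map)
open import Data.List using (List; []; _∷_; [_]; concatMap; allFin; filter; length; foldr; upTo)
open import Data.Nat.ListAction using (product)
import Data.List as L
open import Data.Product using (Σ; ∃; _×_; _,_)
open import Relation.Nullary using (Dec; ¬_)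
open import Relation.Nullary.Decidable using (_×-dec_; _→-dec_; ¬?)
open import Relation.Binary.PropositionalEquality using (_≡_)
open import Data.Fin using (_≟_)

-- Conventions: everything 0-indexed.  Positions (parking spots) and
-- values (cars) are elements of Fin n; the paper's index i corresponds
-- to toℕ i + 1.  A permutation π in one-line notation is a bijection
-- Fin n ↔ Fin n with  π_j = π ⟨$⟩ʳ j  and  π⁻¹_i = π ⟨$⟩ˡ i.

pos : ∀ {n} → Permutation′ n → Fin n → Fin n
pos π i = π ⟨$⟩ˡ i

Earlier : ∀ {n} → Permutation′ n → Fin n → Fin n → Set
Earlier {n} π i j = Σ (Fin n) λ i' → (toℕ i' < toℕ i) × (pos π i' ≡ j)

IsSmallestNew : ∀ {n} → Permutation′ n → Fin n → Subset n → Set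
IsSmallestNew {n} π i C =
  (pos π i ∈ C) × (¬ Earlier π i (pos π i)) ×
  ((j : Fin n) → toℕ j < toℕ (pos π i) → j ∈ C → Earlier π i j)

IsSPF : ∀ {n} → Vec (Subset n) n → Permutation′ n → Set
IsSPF {n} C π = (i : Fin n) → IsSmallestNew π i (lookup C i)

earlier? : ∀ {n} (π : Permutation′ n) i j → Dec (Earlier π i j)
earlier? π i j = any? (λ i' → (toℕ i' <? toℕ i) ×-dec (pos π i' ≟ j))

isSmallestNew? : ∀ {n} (π : Permutation′ n) i C → Dec (IsSmallestNew π i C)
isSmallestNew? π i C =
  (pos π i ∈? C) ×-dec ¬? (earlier? π i (pos π i)) ×-dec
  all? (λ j → (toℕ j <? toℕ (pos π i)) →-dec ((j ∈? C) →-dec earlier? π i j))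

isSPF? : ∀ {n} (C : Vec (Subset n) n) (π : Permutation′ n) → Dec (IsSPF C π)
isSPF? C π = all? (λ i → isSmallestNew? π i (lookup C i))

-- For s ≤ n ∸ k it is contained in Fin n and has
-- exactly k elements; every k-element interval of [n] arises from exactly
-- one such s (when 1 ≤ k ≤ n).
interval : ∀ {n} (k : ℕ) → ℕ → Subset n
interval k s = tabulate (λ j → (s ≤ᵇ toℕ j) ∧ (toℕ j <ᵇ s + k))

allVecs : (m n : ℕ) → List (Vec (Fin m) n)
allVecs m zero = [ [] ]
allVecs m (suc n) = concatMap (λ x → Data.List.map (x ∷_) (allVecs m n)) (allFin m)

intervals : ∀ {n} (k : ℕ) → Vec (Fin (suc (n ∸ k))) n → Vec (Subset n) n
intervals k ss = map (λ s → interval k (toℕ s)) ss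

IPF : (k n : ℕ) → Permutation′ n → ℕ
IPF k n π = length (filter (λ ss → isSPF? (intervals k ss) π) (allVecs (suc (n ∸ k)) n))

-- π ∈ S_n^k : π_n > π_{n-1} > ⋯ > π_{n-k+1}
-- (for consecutive positions p, p+1 among the last k, π_p < π_{p+1})
InSnk : (k n : ℕ) → Permutation′ n → Set
InSnk k n π = (p q : Fin n) → n ∸ k + 1 ≤ toℕ p + 1 → toℕ q ≡ suc (toℕ p) →
              toℕ (π ⟨$⟩ʳ p) < toℕ (π ⟨$⟩ʳ q)

-- a_i(π): the largest j with 1 ≤ j ≤ i such that π_i ≥ π_{i'} for all
-- i-j+1 ≤ i' ≤ i (paper indices; here the position is p : Fin n, i = toℕ p + 1)
aCond : ∀ {n} → Permutation′ n → Fin n → ℕ → Set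
aCond {n} π p j = (p' : Fin n) → (toℕ p + 1) ∸ j + 1 ≤ toℕ p' + 1 → toℕ p' ≤ toℕ p →
                  toℕ (π ⟨$⟩ʳ p') ≤ toℕ (π ⟨$⟩ʳ p)

aCond? : ∀ {n} (π : Permutation′ n) p j → Dec (aCond π p j)
aCond? π p j = all? (λ p' → ((toℕ p + 1) ∸ j + 1 ≤? toℕ p' + 1) →-dec
                            ((toℕ p' ≤? toℕ p) →-dec
                             (toℕ (π ⟨$⟩ʳ _) ≤? toℕ (π ⟨$⟩ʳ p))))

oneTo : ℕ → List ℕ
oneTo m = L.map suc (upTo m)

maxList : List ℕ → ℕ
maxList = foldr _⊔_ 0

a : ∀ {n} → Permutation′ n → Fin n → ℕ
a π p = maxList (filter (aCond? π p) (oneTo (toℕ p + 1)))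

firstPositions : (k n : ℕ) → List (Fin n)
firstPositions k n = filter (λ p → toℕ p + 1 ≤? n ∸ k) (allFin n)

lastPositions : (k n : ℕ) → List (Fin n)
lastPositions k n = filter (λ p → n ∸ k + 1 ≤? toℕ p + 1) (allFin n)

-- ∏_{i=1}^{n-k} min{a_i, k} · ∏_{i=n-k+1}^{n} min{n-i-k+a_i+1, n-i+1}
-- (with i = toℕ p + 1; the quantity n-i-k+a_i+1 is written
--  (n + a_i + 1) ∸ (i + k), which equals it whenever it is ≥ 0, in
--  particular for all π ∈ S_n^k, where it is ≥ 1)
formula : (k n : ℕ) → Permutation′ n → ℕ
formula k n π =
  product (L.map (λ p → a π p ⊓ k) (firstPositions k n)) *
  product (L.map (λ p → ((n + a π p + 1) ∸ (toℕ p + 1 + k)) ⊓ (n + 1 ∸ (toℕ p + 1)))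
                 (lastPositions k n))

module Submission where

-- Everything is 0-indexed: spots p and cars i are elements of Fin n, and
-- car i parks at spot p = π⁻¹(i).  The whole count rests on one local fact
-- (parks⇔InWindow): car i, whose interval starts at s, parks at p exactly
-- when s lies in the window  p+1 − min(k, a_p) ≤ s ≤ p.  Indeed p has to lie
-- in [s, s+k), and every spot of [s, p) has to be taken by a smaller car,
-- i.e. π_p must dominate π_s, …, π_p, which by definition of a_p means that
-- the window [s, p] has length at most a_p (Dominates⇔).
--
-- The windows of different cars do not interact, so IPF_k(n,π) is the
-- product over the cars, and after reindexing through π over the spots, of
-- the number of starting points 0 … n−k in the window (IPF≡∏windowSize).
-- Elementary arithmetic identifies this window size with the factor of the
-- formula at p, for every permutation π (IPF≡formula).  Finally, when π is
-- not in S_n^k, a descent π_p > π_{p+1} among the last k spots forces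
-- a_{p+1} = 1, so the factor at p+1 vanishes (∉Snk⇒formula≡0).

open import Defs
open import Data.Nat
  using (ℕ; zero; suc; _+_; _*_; _∸_; _⊓_; _≤_; _<_; _≤?_; _<?_; _≟_; _≤ᵇ_; _<ᵇ_; z≤n; s≤s)
open import Data.Nat.Properties
open import Data.Nat.Divisibility using (_∣_; 0∣⇒≡0)
open import Data.Nat.ListAction using (sum; product)
open import Data.Nat.ListAction.Properties using (∈⇒∣product)
open import Data.Nat.Solver using (module +-*-Solver)
open import Algebra.Properties.CommutativeMonoid.Sum *-1-commutativeMonoid
  using () renaming (sum to ∏; sum-cong-≗ to ∏-cong; sum-permute to ∏-permute)
open import Algebra.Properties.CommutativeSemigroup *-commutativeSemigroup
  using (x∙yz≈y∙xz)
open import Data.Bool using (_∧_)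
open import Data.Bool.Properties using (T-≡; T-∧)
open import Data.Fin using (Fin; zero; suc; toℕ)
open import Data.Fin.Properties using (toℕ-injective; all?)
open import Data.Fin.Subset using (Subset; _∈_)
open import Data.Fin.Permutation
  using (Permutation′; _⟨$⟩ʳ_; _⟨$⟩ˡ_; inverseˡ; inverseʳ; flip)
open import Data.List
  using (List; []; _∷_; [_]; _++_; filter; length; map; concatMap; tabulate;
         allFin; upTo; applyUpTo)
open import Data.List.Properties
  using (filter-++; filter-≐; filter-none; filter-accept; filter-reject; length-++;
         map-tabulate; upTo-∷ʳ)
open import Data.List.Membership.Propositional using () renaming (_∈_ to _∈ₗ_)
open import Data.List.Membership.Propositional.Properties
  using (∈-filter⁺; ∈-filter⁻; ∈-map⁺; ∈-map⁻; ∈-upTo⁺; ∈-upTo⁻; ∈-allFin)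
open import Data.List.Relation.Unary.All using (universal)
open import Data.List.Relation.Unary.Any using (here; there)
open import Data.Vec using (Vec; lookup) renaming ([] to []ᵥ; _∷_ to _∷ᵥ_)
open import Data.Vec.Properties using (lookup-map; lookup∘tabulate; []=⇒lookup; lookup⇒[]=)
open import Data.Product using (_×_; _,_; proj₁; proj₂)
open import Data.Sum using (_⊎_; inj₁; inj₂)
open import Function using (_∘_; id; _⇔_; mk⇔; Equivalence)
open import Relation.Nullary using (yes; no; ¬_; contradiction)
open import Relation.Nullary.Decidable using (_×-dec_; decidable-stable)
open import Relation.Unary using (Decidable; _≐_)
open import Relation.Binary.PropositionalEquality
  using (_≡_; _≢_; refl; sym; trans; cong; cong₂; subst; module ≡-Reasoning)

open Equivalence using (to; from)

module _ {A B : Set} {P : B → Set} (P? : Decidable P) where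

  length-filter-map : (f : A → B) (xs : List A) →
                      length (filter P? (map f xs)) ≡ length (filter (P? ∘ f) xs)
  length-filter-map f []       = refl
  length-filter-map f (x ∷ xs) with P? (f x)
  ... | yes _ = cong suc (length-filter-map f xs)
  ... | no  _ = length-filter-map f xs

  length-filter-concatMap : (F : A → List B) (xs : List A) →
    length (filter P? (concatMap F xs)) ≡ sum (map (λ x → length (filter P? (F x))) xs)
  length-filter-concatMap F []       = refl
  length-filter-concatMap F (x ∷ xs) = begin
    length (filter P? (F x ++ concatMap F xs))
      ≡⟨ cong length (filter-++ P? (F x) (concatMap F xs)) ⟩
    length (filter P? (F x) ++ filter P? (concatMap F xs))
      ≡⟨ length-++ (filter P? (F x)) ⟩
    length (filter P? (F x)) + length (filter P? (concatMap F xs))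
      ≡⟨ cong (length (filter P? (F x)) +_) (length-filter-concatMap F xs) ⟩
    length (filter P? (F x)) + sum (map (λ x → length (filter P? (F x))) xs) ∎
    where open ≡-Reasoning

module _ {A : Set} {P : A → Set} (P? : Decidable P) (N : ℕ) (g : A → ℕ)
         (onP : ∀ x → P x → g x ≡ N) (offP : ∀ x → ¬ P x → g x ≡ 0) where

  sum-indicator : ∀ xs → sum (map g xs) ≡ length (filter P? xs) * N
  sum-indicator []       = refl
  sum-indicator (x ∷ xs) with P? x
  ... | yes px = cong₂ _+_ (onP x px) (sum-indicator xs)
  ... | no ¬px = cong₂ _+_ (offP x ¬px) (sum-indicator xs)

module _ {A : Set} {P R : A → Set} (P? : Decidable P) (R? : Decidable R)
         (f g h : A → ℕ) (onP : ∀ x → P x → h x ≡ f x) (onR : ∀ x → R x → h x ≡ g x)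
         (P⇒¬R : ∀ x → P x → ¬ R x) (¬P⇒R : ∀ x → ¬ P x → R x) where

  product-partition : ∀ xs →
    product (map h xs) ≡ product (map f (filter P? xs)) * product (map g (filter R? xs))
  product-partition []       = refl
  product-partition (x ∷ xs) with P? x | R? x
  ... | yes px | yes rx = contradiction rx (P⇒¬R x px)
  ... | no ¬px | no ¬rx = contradiction (¬P⇒R x ¬px) ¬rx
  ... | yes px | no _   = begin
    h x * product (map h xs)  ≡⟨ cong₂ _*_ (onP x px) (product-partition xs) ⟩
    f x * (Πf * Πg)           ≡⟨ *-assoc (f x) Πf Πg ⟨
    f x * Πf * Πg             ∎
    where
    open ≡-Reasoning
    Πf Πg : ℕ
    Πf = product (map f (filter P? xs))
    Πg = product (map g (filter R? xs))
  ... | no _   | yes rx = begin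
    h x * product (map h xs)  ≡⟨ cong₂ _*_ (onR x rx) (product-partition xs) ⟩
    g x * (Πf * Πg)           ≡⟨ x∙yz≈y∙xz (g x) Πf Πg ⟩
    Πf * (g x * Πg)           ∎
    where
    open ≡-Reasoning
    Πf Πg : ℕ
    Πf = product (map f (filter P? xs))
    Πg = product (map g (filter R? xs))

product-tabulate : ∀ {A : Set} {n} (f : A → ℕ) (g : Fin n → A) →
                   product (map f (tabulate g)) ≡ ∏ (f ∘ g)
product-tabulate {n = zero}  f g = refl
product-tabulate {n = suc n} f g = cong (f (g zero) *_) (product-tabulate f (g ∘ suc))

count-allVecs : ∀ m n (D : Fin n → Fin m → Set) (D? : ∀ i → Decidable (D i))
  (E? : Decidable (λ (ss : Vec (Fin m) n) → ∀ i → D i (lookup ss i))) →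
  length (filter E? (allVecs m n)) ≡ ∏ (λ i → length (filter (D? i) (allFin m)))
count-allVecs m zero D D? E? with E? []ᵥ
... | yes _ = refl
... | no ¬E = contradiction (λ ()) ¬E
count-allVecs m (suc n) D D? E? = begin
  length (filter E? (concatMap withHead (allFin m)))
    ≡⟨ length-filter-concatMap E? withHead (allFin m) ⟩
  sum (map (λ x → length (filter E? (withHead x))) (allFin m))
    ≡⟨ sum-indicator (D? zero) tailCount _ goodHead badHead (allFin m) ⟩
  length (filter (D? zero) (allFin m)) * tailCount ∎
  where
  open ≡-Reasoning
  withHead : Fin m → List (Vec (Fin m) (suc n))
  withHead x = map (x ∷ᵥ_) (allVecs m n)
  tailCount : ℕ
  tailCount = ∏ (λ i → length (filter (D? (suc i)) (allFin m)))
  E′? : Decidable (λ (ss : Vec (Fin m) n) → ∀ i → D (suc i) (lookup ss i))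
  E′? ss = all? (λ i → D? (suc i) (lookup ss i))
  goodHead : ∀ x → D zero x → length (filter E? (withHead x)) ≡ tailCount
  goodHead x d = begin
    length (filter E? (withHead x))
      ≡⟨ length-filter-map E? (x ∷ᵥ_) (allVecs m n) ⟩
    length (filter (E? ∘ (x ∷ᵥ_)) (allVecs m n))
      ≡⟨ cong length (filter-≐ (E? ∘ (x ∷ᵥ_)) E′? (tailOK , consOK) (allVecs m n)) ⟩
    length (filter E′? (allVecs m n))
      ≡⟨ count-allVecs m n (D ∘ suc) (D? ∘ suc) E′? ⟩
    tailCount ∎
    where
    tailOK : ∀ {ss} → (∀ i → D i (lookup (x ∷ᵥ ss) i)) → ∀ i → D (suc i) (lookup ss i)
    tailOK e i = e (suc i)
    consOK : ∀ {ss} → (∀ i → D (suc i) (lookup ss i)) → ∀ i → D i (lookup (x ∷ᵥ ss) i)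
    consOK e zero    = d
    consOK e (suc i) = e i
  badHead : ∀ x → ¬ D zero x → length (filter E? (withHead x)) ≡ 0
  badHead x ¬d = trans (length-filter-map E? (x ∷ᵥ_) (allVecs m n))
    (cong length (filter-none (E? ∘ (x ∷ᵥ_)) (universal (λ _ e → ¬d (e zero)) (allVecs m n))))

InWindow : ℕ → ℕ → ℕ → Set
InWindow L U s = L ≤ s × s ≤ U

inWindow? : ∀ L U → Decidable (InWindow L U)
inWindow? L U s = (L ≤? s) ×-dec (s ≤? U)

-- Passing from the range [0, m) to [0, m]: the window [L, U] gains the point m
-- if it contains it, and is unchanged otherwise.
window-grow : ∀ L U m → InWindow L U m → (suc U ⊓ suc m) ∸ L ≡ (suc U ⊓ m) ∸ L + 1
window-grow L U m (L≤m , m≤U) = begin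
  (suc U ⊓ suc m) ∸ L  ≡⟨ cong (_∸ L) (m≥n⇒m⊓n≡n (s≤s m≤U)) ⟩
  suc m ∸ L            ≡⟨ +-∸-assoc 1 L≤m ⟩
  suc (m ∸ L)          ≡⟨ +-comm 1 (m ∸ L) ⟩
  m ∸ L + 1            ≡⟨ cong (λ z → z ∸ L + 1) (m≥n⇒m⊓n≡n (m≤n⇒m≤1+n m≤U)) ⟨
  (suc U ⊓ m) ∸ L + 1  ∎
  where open ≡-Reasoning

window-same : ∀ L U m → ¬ InWindow L U m → (suc U ⊓ suc m) ∸ L ≡ (suc U ⊓ m) ∸ L
window-same L U m m∉ with m ≤? U
... | no m≰U = cong (_∸ L) (trans (m≤n⇒m⊓n≡m (m≤n⇒m≤1+n U<m)) (sym (m≤n⇒m⊓n≡m U<m)))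
  where
  U<m : U < m
  U<m = ≰⇒> m≰U
... | yes m≤U = trans (m≤n⇒m∸n≡0 (≤-trans (m⊓n≤n (suc U) (suc m)) m<L))
                      (sym (m≤n⇒m∸n≡0 (≤-trans (m⊓n≤n (suc U) m) (<⇒≤ m<L))))
  where
  m<L : m < L
  m<L = ≰⇒> (λ L≤m → m∉ (L≤m , m≤U))

count-window : ∀ L U m → length (filter (inWindow? L U) (upTo m)) ≡ (suc U ⊓ m) ∸ L
count-window L U zero    = sym (0∸n≡0 L)
count-window L U (suc m) = begin
  length (filter (inWindow? L U) (upTo (suc m)))
    ≡⟨ cong (length ∘ filter (inWindow? L U)) (upTo-∷ʳ m) ⟨
  length (filter (inWindow? L U) (upTo m ++ [ m ]))
    ≡⟨ cong length (filter-++ (inWindow? L U) (upTo m) [ m ]) ⟩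
  length (filter (inWindow? L U) (upTo m) ++ filter (inWindow? L U) [ m ])
    ≡⟨ length-++ (filter (inWindow? L U) (upTo m)) ⟩
  length (filter (inWindow? L U) (upTo m)) + length (filter (inWindow? L U) [ m ])
    ≡⟨ cong (_+ length (filter (inWindow? L U) [ m ])) (count-window L U m) ⟩
  (suc U ⊓ m) ∸ L + length (filter (inWindow? L U) [ m ])
    ≡⟨ lastPoint ⟩
  (suc U ⊓ suc m) ∸ L ∎
  where
  open ≡-Reasoning
  lastPoint : (suc U ⊓ m) ∸ L + length (filter (inWindow? L U) [ m ]) ≡ (suc U ⊓ suc m) ∸ L
  lastPoint with inWindow? L U m
  ... | yes m∈ = trans (cong (λ l → (suc U ⊓ m) ∸ L + length l) (filter-accept (inWindow? L U) m∈))
                       (sym (window-grow L U m m∈))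
  ... | no  m∉ = trans (cong (λ l → (suc U ⊓ m) ∸ L + length l) (filter-reject (inWindow? L U) m∉))
                       (trans (+-identityʳ ((suc U ⊓ m) ∸ L)) (sym (window-same L U m m∉)))

tabulate∘toℕ : ∀ {A : Set} m (f : ℕ → A) → tabulate (f ∘ toℕ {m}) ≡ applyUpTo f m
tabulate∘toℕ zero    f = refl
tabulate∘toℕ (suc m) f = cong (f 0 ∷_) (tabulate∘toℕ m (f ∘ suc))

count-window-Fin : ∀ L U m →
  length (filter (inWindow? L U ∘ toℕ) (allFin m)) ≡ (suc U ⊓ m) ∸ L
count-window-Fin L U m = begin
  length (filter (inWindow? L U ∘ toℕ) (allFin m))
    ≡⟨ length-filter-map (inWindow? L U) toℕ (allFin m) ⟨
  length (filter (inWindow? L U) (map toℕ (allFin m)))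
    ≡⟨ cong (length ∘ filter (inWindow? L U)) (trans (map-tabulate id toℕ) (tabulate∘toℕ m id)) ⟩
  length (filter (inWindow? L U) (upTo m))
    ≡⟨ count-window L U m ⟩
  (suc U ⊓ m) ∸ L ∎
  where open ≡-Reasoning

m∸n≤o⇔m≤n+o : ∀ m n o → m ∸ n ≤ o ⇔ m ≤ n + o
m∸n≤o⇔m≤n+o m n o = mk⇔ (λ h → ≤-trans (m≤n+m∸n m n) (+-monoʳ-≤ n h)) (m≤n+o⇒m∸n≤o m n)

m∸⊓≤⇔ : ∀ m s x y → m ∸ (x ⊓ y) ≤ s ⇔ (m ≤ s + x × m ≤ s + y)
m∸⊓≤⇔ m s x y = mk⇔
  (λ h → let h′ = bound (to (m∸n≤o⇔m≤n+o m (x ⊓ y) s) h) in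
         m≤n⊓o⇒m≤n (s + x) (s + y) h′ , m≤n⊓o⇒m≤o (s + x) (s + y) h′)
  (λ (hx , hy) → from (m∸n≤o⇔m≤n+o m (x ⊓ y) s) (unbound (⊓-glb hx hy)))
  where
  sum≡ : x ⊓ y + s ≡ (s + x) ⊓ (s + y)
  sum≡ = trans (+-comm (x ⊓ y) s) (+-distribˡ-⊓ s x y)
  bound : m ≤ x ⊓ y + s → m ≤ (s + x) ⊓ (s + y)
  bound = subst (m ≤_) sum≡
  unbound : m ≤ (s + x) ⊓ (s + y) → m ≤ x ⊓ y + s
  unbound = subst (m ≤_) (sym sum≡)

∈-interval : ∀ {n} k s (j : Fin n) → j ∈ interval k s ⇔ (s ≤ toℕ j × toℕ j < s + k)
∈-interval k s j = mk⇔ out inn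
  where
  entry : lookup (interval k s) j ≡ (s ≤ᵇ toℕ j) ∧ (toℕ j <ᵇ s + k)
  entry = lookup∘tabulate (λ j → (s ≤ᵇ toℕ j) ∧ (toℕ j <ᵇ s + k)) j
  out : j ∈ interval k s → s ≤ toℕ j × toℕ j < s + k
  out j∈ with to T-∧ (from T-≡ (trans (sym entry) ([]=⇒lookup j∈)))
  ... | s≤j , j<s+k = ≤ᵇ⇒≤ s (toℕ j) s≤j , <ᵇ⇒< (toℕ j) (s + k) j<s+k
  inn : s ≤ toℕ j × toℕ j < s + k → j ∈ interval k s
  inn (s≤j , j<s+k) = lookup⇒[]= j _ (trans entry (to T-≡ (from T-∧ (≤⇒≤ᵇ s≤j , <⇒<ᵇ j<s+k))))

⟨$⟩ʳ-injective : ∀ {n} (π : Permutation′ n) {p q} → π ⟨$⟩ʳ p ≡ π ⟨$⟩ʳ q → p ≡ q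
⟨$⟩ʳ-injective π e =
  trans (sym (inverseˡ π)) (trans (cong (π ⟨$⟩ˡ_) e) (inverseˡ π))

maxList-ub : ∀ {x xs} → x ∈ₗ xs → x ≤ maxList xs
maxList-ub {xs = y ∷ ys} (here refl) = m≤m⊔n y (maxList ys)
maxList-ub {xs = y ∷ ys} (there x∈) = ≤-trans (maxList-ub x∈) (m≤n⊔m y (maxList ys))

maxList-sel : ∀ xs → maxList xs ≡ 0 ⊎ maxList xs ∈ₗ xs
maxList-sel []       = inj₁ refl
maxList-sel (x ∷ xs) with ⊔-sel x (maxList xs)
... | inj₁ e = inj₂ (here e)
... | inj₂ e with maxList-sel xs
...   | inj₁ z  = inj₁ (trans e z)
...   | inj₂ m∈ = inj₂ (there (subst (_∈ₗ xs) (sym e) m∈))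

∈-oneTo : ∀ {j m} → j ∈ₗ oneTo m ⇔ (1 ≤ j × j ≤ m)
∈-oneTo {j} {m} = mk⇔ out inn
  where
  out : j ∈ₗ oneTo m → 1 ≤ j × j ≤ m
  out j∈ with ∈-map⁻ suc j∈
  ... | _ , i∈ , refl = s≤s z≤n , ∈-upTo⁻ i∈
  inn : 1 ≤ j × j ≤ m → j ∈ₗ oneTo m
  inn (s≤s _ , j≤m) = ∈-map⁺ suc (∈-upTo⁺ j≤m)

module _ {n : ℕ} (π : Permutation′ n) where

  aCond-anti : ∀ p {j j′} → j′ ≤ j → aCond π p j → aCond π p j′
  aCond-anti p j′≤j c p′ start≤p′ p′≤p =
    c p′ (≤-trans (+-monoˡ-≤ 1 (∸-monoʳ-≤ (toℕ p + 1) j′≤j)) start≤p′) p′≤p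

  aCond-1 : ∀ p → aCond π p 1
  aCond-1 p p′ start≤p′ p′≤p = ≤-reflexive (cong (λ z → toℕ (π ⟨$⟩ʳ z)) p′≡p)
    where
    p≤p′ : toℕ p ≤ toℕ p′
    p≤p′ = +-cancelʳ-≤ 1 (toℕ p) (toℕ p′)
             (subst (λ z → z + 1 ≤ toℕ p′ + 1) (m+n∸n≡m (toℕ p) 1) start≤p′)
    p′≡p : p′ ≡ p
    p′≡p = toℕ-injective (≤-antisym p′≤p p≤p′)

  candidates : Fin n → List ℕ
  candidates p = filter (aCond? π p) (oneTo (toℕ p + 1))

  ∈-candidates : ∀ p {j} → 1 ≤ j → j ≤ toℕ p + 1 → aCond π p j → j ∈ₗ candidates p
  ∈-candidates p 1≤j j≤p+1 = ∈-filter⁺ (aCond? π p) (from ∈-oneTo (1≤j , j≤p+1))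

  a-maximal : ∀ p j → 1 ≤ j → j ≤ toℕ p + 1 → aCond π p j → j ≤ a π p
  a-maximal p j 1≤j j≤p+1 c = maxList-ub (∈-candidates p 1≤j j≤p+1 c)

  -- ... and it is itself admissible, as 1 is always a candidate.
  a-admissible : ∀ p → aCond π p (a π p) × a π p ≤ toℕ p + 1
  a-admissible p with maxList-sel (candidates p)
  ... | inj₁ a≡0 =
    contradiction (subst (1 ≤_) a≡0 (a-maximal p 1 ≤-refl (m≤n+m 1 (toℕ p)) (aCond-1 p))) λ ()
  ... | inj₂ a∈ with ∈-filter⁻ (aCond? π p) {xs = oneTo (toℕ p + 1)} a∈
  ...   | a∈oneTo , c = c , proj₂ (to ∈-oneTo a∈oneTo)

  Dominates : ℕ → Fin n → Set
  Dominates s p = ∀ p′ → s ≤ toℕ p′ → toℕ p′ ≤ toℕ p → toℕ (π ⟨$⟩ʳ p′) ≤ toℕ (π ⟨$⟩ʳ p)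

  aCond⇔Dominates : ∀ p s → s ≤ toℕ p → aCond π p (toℕ p + 1 ∸ s) ⇔ Dominates s p
  aCond⇔Dominates p s s≤p = mk⇔
    (λ c p′ s≤p′ → c p′ (subst (λ z → z + 1 ≤ toℕ p′ + 1) (sym start≡s) (+-monoˡ-≤ 1 s≤p′)))
    (λ d p′ start≤p′ → d p′ (+-cancelʳ-≤ 1 s (toℕ p′)
                                (subst (λ z → z + 1 ≤ toℕ p′ + 1) start≡s start≤p′)))
    where
    start≡s : toℕ p + 1 ∸ (toℕ p + 1 ∸ s) ≡ s
    start≡s = m∸[m∸n]≡n (m≤n⇒m≤n+o 1 s≤p)

  Dominates⇔ : ∀ p s → s ≤ toℕ p → Dominates s p ⇔ toℕ p + 1 ≤ s + a π p
  Dominates⇔ p s s≤p = mk⇔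
    (λ d → to (m∸n≤o⇔m≤n+o (toℕ p + 1) s (a π p))
              (a-maximal p (toℕ p + 1 ∸ s) 1≤len (m∸n≤m (toℕ p + 1) s)
                 (from (aCond⇔Dominates p s s≤p) d)))
    (λ h → to (aCond⇔Dominates p s s≤p)
              (aCond-anti p (from (m∸n≤o⇔m≤n+o (toℕ p + 1) s (a π p)) h) (proj₁ (a-admissible p))))
    where
    1≤len : 1 ≤ toℕ p + 1 ∸ s
    1≤len = m<n⇒0<n∸m (subst (s <_) (+-comm 1 (toℕ p)) (s≤s s≤p))

Earlier⇔ : ∀ {n} (π : Permutation′ n) i j → Earlier π i j ⇔ toℕ (π ⟨$⟩ʳ j) < toℕ i
Earlier⇔ π i j = mk⇔ out (λ lt → π ⟨$⟩ʳ j , lt , inverseˡ π)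
  where
  out : Earlier π i j → toℕ (π ⟨$⟩ʳ j) < toℕ i
  out (i′ , i′<i , refl) = subst (λ z → toℕ z < toℕ i) (sym (inverseʳ π)) i′<i

windowStart : ∀ {n} → ℕ → Permutation′ n → Fin n → ℕ
windowStart k π p = toℕ p + 1 ∸ (k ⊓ a π p)

parks⇔InWindow : ∀ {n} k (π : Permutation′ n) i s →
  IsSmallestNew π i (interval k s) ⇔ InWindow (windowStart k π (pos π i)) (toℕ (pos π i)) s
parks⇔InWindow {n} k π i s = mk⇔ parks⇒ ⇒parks
  where
  p : Fin n
  p = pos π i
  πp≡i : π ⟨$⟩ʳ p ≡ i
  πp≡i = inverseʳ π
  start≤s⇔ : windowStart k π p ≤ s ⇔ (toℕ p + 1 ≤ s + k × toℕ p + 1 ≤ s + a π p)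
  start≤s⇔ = m∸⊓≤⇔ (toℕ p + 1) s k (a π p)

  parks⇒ : IsSmallestNew π i (interval k s) → InWindow (windowStart k π p) (toℕ p) s
  parks⇒ (p∈ , _ , takenBelow) =
    from start≤s⇔ (subst (_≤ s + k) (+-comm 1 (toℕ p)) p<s+k ,
                   to (Dominates⇔ π p s s≤p) dominates) , s≤p
    where
    s≤p : s ≤ toℕ p
    s≤p = proj₁ (to (∈-interval k s p) p∈)
    p<s+k : toℕ p < s + k
    p<s+k = proj₂ (to (∈-interval k s p) p∈)
    -- every spot p′ ∈ [s, p) lies in the interval, hence holds a smaller car
    dominates : Dominates π s p
    dominates p′ s≤p′ p′≤p with m≤n⇒m<n∨m≡n p′≤p
    ... | inj₂ p′≡p = ≤-reflexive (cong (λ z → toℕ (π ⟨$⟩ʳ z)) (toℕ-injective p′≡p))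
    ... | inj₁ p′<p = <⇒≤ (subst (λ z → toℕ (π ⟨$⟩ʳ p′) < toℕ z) (sym πp≡i)
            (to (Earlier⇔ π i p′)
                (takenBelow p′ p′<p (from (∈-interval k s p′) (s≤p′ , <-trans p′<p p<s+k)))))

  ⇒parks : InWindow (windowStart k π p) (toℕ p) s → IsSmallestNew π i (interval k s)
  ⇒parks (start≤s , s≤p) =
    from (∈-interval k s p) (s≤p , subst (_≤ s + k) (+-comm (toℕ p) 1) p+1≤s+k) ,
    notTaken , takenBelow
    where
    p+1≤s+k : toℕ p + 1 ≤ s + k
    p+1≤s+k = proj₁ (to start≤s⇔ start≤s)
    dominates : Dominates π s p
    dominates = from (Dominates⇔ π p s s≤p) (proj₂ (to start≤s⇔ start≤s))
    notTaken : ¬ Earlier π i p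
    notTaken e = <-irrefl (cong toℕ πp≡i) (to (Earlier⇔ π i p) e)
    takenBelow : ∀ j → toℕ j < toℕ p → j ∈ interval k s → Earlier π i j
    takenBelow j j<p j∈ = from (Earlier⇔ π i j) (subst (λ z → toℕ (π ⟨$⟩ʳ j) < toℕ z) πp≡i
        (≤∧≢⇒< (dominates j (proj₁ (to (∈-interval k s j) j∈)) (<⇒≤ j<p)) πj≢πp))
      where
      πj≢πp : toℕ (π ⟨$⟩ʳ j) ≢ toℕ (π ⟨$⟩ʳ p)
      πj≢πp e = <-irrefl (cong toℕ (⟨$⟩ʳ-injective π (toℕ-injective e))) j<p

windowSize : (k n : ℕ) → Permutation′ n → Fin n → ℕ
windowSize k n π p = (suc (toℕ p) ⊓ suc (n ∸ k)) ∸ windowStart k π p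

-- The cars choose their starting points independently, each within its window.
IPF≡∏windowSize : ∀ k n (π : Permutation′ n) → IPF k n π ≡ ∏ (windowSize k n π)
IPF≡∏windowSize k n π = begin
  IPF k n π
    ≡⟨ cong length (filter-≐ (λ ss → isSPF? (intervals k ss) π) E? spf≐windows
                             (allVecs (suc (n ∸ k)) n)) ⟩
  length (filter E? (allVecs (suc (n ∸ k)) n))
    ≡⟨ count-allVecs (suc (n ∸ k)) n CarWindow carWindow? E? ⟩
  ∏ (count ∘ pos π)
    ≡⟨ ∏-permute count (flip π) ⟨
  ∏ count
    ≡⟨ ∏-cong (λ p → count-window-Fin (windowStart k π p) (toℕ p) (suc (n ∸ k))) ⟩
  ∏ (windowSize k n π) ∎
  where
  open ≡-Reasoning
  CarWindow : Fin n → Fin (suc (n ∸ k)) → Set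
  CarWindow i s = InWindow (windowStart k π (pos π i)) (toℕ (pos π i)) (toℕ s)
  carWindow? : ∀ i → Decidable (CarWindow i)
  carWindow? i s = inWindow? (windowStart k π (pos π i)) (toℕ (pos π i)) (toℕ s)
  E? : Decidable (λ (ss : Vec (Fin (suc (n ∸ k))) n) → ∀ i → CarWindow i (lookup ss i))
  E? ss = all? (λ i → carWindow? i (lookup ss i))
  count : Fin n → ℕ
  count p = length (filter (inWindow? (windowStart k π p) (toℕ p) ∘ toℕ) (allFin (suc (n ∸ k))))
  intervalAt : Fin (suc (n ∸ k)) → Subset n
  intervalAt s = interval k (toℕ s)
  spf⇒windows : ∀ ss → IsSPF (intervals k ss) π → ∀ i → CarWindow i (lookup ss i)
  spf⇒windows ss spf i = to (parks⇔InWindow k π i (toℕ (lookup ss i)))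
    (subst (IsSmallestNew π i) (lookup-map i intervalAt ss) (spf i))
  windows⇒spf : ∀ ss → (∀ i → CarWindow i (lookup ss i)) → IsSPF (intervals k ss) π
  windows⇒spf ss w i = subst (IsSmallestNew π i) (sym (lookup-map i intervalAt ss))
    (from (parks⇔InWindow k π i (toℕ (lookup ss i))) (w i))
  spf≐windows : (λ ss → IsSPF (intervals k ss) π) ≐ (λ ss → ∀ i → CarWindow i (lookup ss i))
  spf≐windows = (λ {ss} → spf⇒windows ss) , (λ {ss} → windows⇒spf ss)

firstFactor : ∀ {n} → ℕ → Permutation′ n → Fin n → ℕ
firstFactor k π p = a π p ⊓ k

lastFactor : (k n : ℕ) → Permutation′ n → Fin n → ℕ
lastFactor k n π p = (n + a π p + 1 ∸ (toℕ p + 1 + k)) ⊓ (n + 1 ∸ (toℕ p + 1))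

-- At a spot P < n−k the whole window [P+1−x, P] lies in [0, n−k].
windowSize-first : ∀ P d x → P + 1 ≤ d → x ≤ P + 1 → (suc P ⊓ suc d) ∸ (P + 1 ∸ x) ≡ x
windowSize-first P d x P+1≤d x≤P+1 = begin
  (suc P ⊓ suc d) ∸ (P + 1 ∸ x)  ≡⟨ cong (_∸ (P + 1 ∸ x)) (m≤n⇒m⊓n≡m (m≤n⇒m≤1+n P<d)) ⟩
  suc P ∸ (P + 1 ∸ x)            ≡⟨ cong (_∸ (P + 1 ∸ x)) (+-comm 1 P) ⟩
  P + 1 ∸ (P + 1 ∸ x)            ≡⟨ m∸[m∸n]≡n x≤P+1 ⟩
  x                              ∎
  where
  open ≡-Reasoning
  P<d : suc P ≤ d
  P<d = subst (_≤ d) (+-comm P 1) P+1≤d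

m∸[m+e∸x]≡x∸e : ∀ c e x → x ≤ c + e → c ∸ (c + e ∸ x) ≡ x ∸ e
m∸[m+e∸x]≡x∸e c e x x≤c+e with ≤-total e x
... | inj₁ e≤x = begin
  c ∸ (c + e ∸ x)            ≡⟨ cong (λ z → c ∸ (c + e ∸ z)) (m∸n+n≡m e≤x) ⟨
  c ∸ (c + e ∸ (x ∸ e + e))  ≡⟨ cong (c ∸_) (trans (cong₂ _∸_ (+-comm c e) (+-comm (x ∸ e) e))
                                                   ([m+n]∸[m+o]≡n∸o e c (x ∸ e))) ⟩
  c ∸ (c ∸ (x ∸ e))          ≡⟨ m∸[m∸n]≡n (m≤n+o⇒m∸n≤o x e (subst (x ≤_) (+-comm c e) x≤c+e)) ⟩
  x ∸ e                      ∎
  where open ≡-Reasoning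
... | inj₂ x≤e = begin
  c ∸ (c + e ∸ x)    ≡⟨ cong (c ∸_) (+-∸-assoc c x≤e) ⟩
  c ∸ (c + (e ∸ x))  ≡⟨ m≤n⇒m∸n≡0 (m≤m+n c (e ∸ x)) ⟩
  0                  ≡⟨ m≤n⇒m∸n≡0 x≤e ⟨
  x ∸ e              ∎
  where open ≡-Reasoning

-- At a spot P ≥ n−k the window is cut off at n−k; writing P = (n−k) + e,
-- both sides equal min(y, k) − e.
windowSize-last : ∀ P n k y → k ≤ n → n ∸ k + 1 ≤ P + 1 → k ⊓ y ≤ P + 1 →
  (suc P ⊓ suc (n ∸ k)) ∸ (P + 1 ∸ (k ⊓ y)) ≡ (n + y + 1 ∸ (P + 1 + k)) ⊓ (n + 1 ∸ (P + 1))
windowSize-last P n k y k≤n d+1≤P+1 x≤P+1 = begin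
  (suc P ⊓ suc d) ∸ (P + 1 ∸ x)  ≡⟨ cong (_∸ (P + 1 ∸ x)) (m≥n⇒m⊓n≡n (s≤s d≤P)) ⟩
  suc d ∸ (P + 1 ∸ x)            ≡⟨ cong (λ z → suc d ∸ (z ∸ x)) P+1≡ ⟩
  suc d ∸ (suc d + e ∸ x)        ≡⟨ m∸[m+e∸x]≡x∸e (suc d) e x (subst (x ≤_) P+1≡ x≤P+1) ⟩
  x ∸ e                          ≡⟨ cong (_∸ e) (⊓-comm k y) ⟩
  (y ⊓ k) ∸ e                    ≡⟨ ∸-distribʳ-⊓ e y k ⟩
  (y ∸ e) ⊓ (k ∸ e)              ≡⟨ cong₂ _⊓_ first≡ last≡ ⟨
  (n + y + 1 ∸ (P + 1 + k)) ⊓ (n + 1 ∸ (P + 1)) ∎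
  where
  open ≡-Reasoning
  open +-*-Solver
  d x : ℕ
  d = n ∸ k
  x = k ⊓ y
  d≤P : d ≤ P
  d≤P = +-cancelʳ-≤ 1 d P d+1≤P+1
  e : ℕ
  e = P ∸ d
  P≡d+e : P ≡ d + e
  P≡d+e = sym (m+[n∸m]≡n d≤P)
  n≡d+k : n ≡ d + k
  n≡d+k = sym (m∸n+n≡m k≤n)
  P+1≡ : P + 1 ≡ suc d + e
  P+1≡ = trans (cong (_+ 1) P≡d+e) (solve 2 (λ d e → d :+ e :+ con 1 := con 1 :+ d :+ e) refl d e)
  first≡ : n + y + 1 ∸ (P + 1 + k) ≡ y ∸ e
  first≡ = begin
    n + y + 1 ∸ (P + 1 + k)
      ≡⟨ cong₂ (λ u v → u + y + 1 ∸ (v + 1 + k)) n≡d+k P≡d+e ⟩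
    d + k + y + 1 ∸ (d + e + 1 + k)
      ≡⟨ cong₂ _∸_ (solve 3 (λ d k y → d :+ k :+ y :+ con 1 := d :+ k :+ con 1 :+ y) refl d k y)
                   (solve 3 (λ d k e → d :+ e :+ con 1 :+ k := d :+ k :+ con 1 :+ e) refl d k e) ⟩
    (d + k + 1) + y ∸ ((d + k + 1) + e)
      ≡⟨ [m+n]∸[m+o]≡n∸o (d + k + 1) y e ⟩
    y ∸ e ∎
  last≡ : n + 1 ∸ (P + 1) ≡ k ∸ e
  last≡ = begin
    n + 1 ∸ (P + 1)
      ≡⟨ cong₂ (λ u v → u + 1 ∸ (v + 1)) n≡d+k P≡d+e ⟩
    d + k + 1 ∸ (d + e + 1)
      ≡⟨ cong₂ _∸_ (solve 2 (λ d k → d :+ k :+ con 1 := d :+ con 1 :+ k) refl d k)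
                   (solve 2 (λ d e → d :+ e :+ con 1 := d :+ con 1 :+ e) refl d e) ⟩
    (d + 1) + k ∸ ((d + 1) + e)
      ≡⟨ [m+n]∸[m+o]≡n∸o (d + 1) k e ⟩
    k ∸ e ∎

IPF≡formula : ∀ k n → k ≤ n → (π : Permutation′ n) → IPF k n π ≡ formula k n π
IPF≡formula k n k≤n π = begin
  IPF k n π                                    ≡⟨ IPF≡∏windowSize k n π ⟩
  ∏ (windowSize k n π)                         ≡⟨ product-tabulate (windowSize k n π) id ⟨
  product (map (windowSize k n π) (allFin n))
    ≡⟨ product-partition isFirst? isLast? (firstFactor k π) (lastFactor k n π) (windowSize k n π)
                         onFirst onLast first⇒¬last ¬first⇒last (allFin n) ⟩
  formula k n π                                ∎
  where
  open ≡-Reasoning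
  isFirst? : Decidable (λ (p : Fin n) → toℕ p + 1 ≤ n ∸ k)
  isFirst? p = toℕ p + 1 ≤? n ∸ k
  isLast? : Decidable (λ (p : Fin n) → n ∸ k + 1 ≤ toℕ p + 1)
  isLast? p = n ∸ k + 1 ≤? toℕ p + 1
  x≤P+1 : ∀ p → k ⊓ a π p ≤ toℕ p + 1
  x≤P+1 p = ≤-trans (m⊓n≤n k (a π p)) (proj₂ (a-admissible π p))
  onFirst : ∀ p → toℕ p + 1 ≤ n ∸ k → windowSize k n π p ≡ firstFactor k π p
  onFirst p first = trans (windowSize-first (toℕ p) (n ∸ k) (k ⊓ a π p) first (x≤P+1 p))
                          (⊓-comm k (a π p))
  onLast : ∀ p → n ∸ k + 1 ≤ toℕ p + 1 → windowSize k n π p ≡ lastFactor k n π p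
  onLast p last = windowSize-last (toℕ p) n k (a π p) k≤n last (x≤P+1 p)
  first⇒¬last : ∀ p → toℕ p + 1 ≤ n ∸ k → ¬ (n ∸ k + 1 ≤ toℕ p + 1)
  first⇒¬last p first last = d+1≰d (≤-trans last first)
    where
    d+1≰d : ¬ (n ∸ k + 1 ≤ n ∸ k)
    d+1≰d = subst (λ z → ¬ (z ≤ n ∸ k)) (+-comm 1 (n ∸ k)) 1+n≰n
  ¬first⇒last : ∀ p → ¬ (toℕ p + 1 ≤ n ∸ k) → n ∸ k + 1 ≤ toℕ p + 1
  ¬first⇒last p ¬first = subst (_≤ toℕ p + 1) (+-comm 1 (n ∸ k)) (≰⇒> ¬first)

descent⇒a≤1 : ∀ {n} (π : Permutation′ n) p q → toℕ q ≡ suc (toℕ p) →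
              ¬ (toℕ (π ⟨$⟩ʳ p) < toℕ (π ⟨$⟩ʳ q)) → a π q ≤ 1
descent⇒a≤1 π p q q≡p+1 descent with a π q ≤? 1
... | yes a≤1 = a≤1
... | no  a≰1 = contradiction ascent descent
  where
  p≤q : toℕ p ≤ toℕ q
  p≤q = subst (toℕ p ≤_) (sym q≡p+1) (n≤1+n (toℕ p))
  -- the window [p, q] has length 2 ≤ a_q, so π_q dominates π_p
  window : toℕ q + 1 ≤ toℕ p + a π q
  window = begin
    toℕ q + 1      ≡⟨ cong (_+ 1) q≡p+1 ⟩
    suc (toℕ p + 1) ≡⟨ +-suc (toℕ p) 1 ⟨
    toℕ p + 2      ≤⟨ +-monoʳ-≤ (toℕ p) (≰⇒> a≰1) ⟩
    toℕ p + a π q  ∎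
    where open ≤-Reasoning
  πp≤πq : toℕ (π ⟨$⟩ʳ p) ≤ toℕ (π ⟨$⟩ʳ q)
  πp≤πq = from (Dominates⇔ π q (toℕ p) p≤q) window p ≤-refl p≤q
  ascent : toℕ (π ⟨$⟩ʳ p) < toℕ (π ⟨$⟩ʳ q)
  ascent = ≤∧≢⇒< πp≤πq λ e → 1+n≰n (≤-reflexive (trans (sym q≡p+1)
             (cong toℕ (sym (⟨$⟩ʳ-injective π (toℕ-injective e))))))

lastFactor≡0 : ∀ k n (π : Permutation′ n) q → k ≤ n → suc (n ∸ k) ≤ toℕ q → a π q ≤ 1 →
               lastFactor k n π q ≡ 0
lastFactor≡0 k n π q k≤n last a≤1 = cong (_⊓ (n + 1 ∸ (toℕ q + 1))) (m≤n⇒m∸n≡0 small)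
  where
  open +-*-Solver
  small : n + a π q + 1 ≤ toℕ q + 1 + k
  small = begin
    n + a π q + 1            ≤⟨ +-monoˡ-≤ 1 (+-monoʳ-≤ n a≤1) ⟩
    n + 1 + 1                ≡⟨ cong (λ z → z + 1 + 1) (m∸n+n≡m k≤n) ⟨
    n ∸ k + k + 1 + 1
      ≡⟨ solve 2 (λ d k → d :+ k :+ con 1 :+ con 1 := con 1 :+ d :+ con 1 :+ k) refl (n ∸ k) k ⟩
    suc (n ∸ k) + 1 + k      ≤⟨ +-monoˡ-≤ k (+-monoˡ-≤ 1 last) ⟩
    toℕ q + 1 + k            ∎
    where open ≤-Reasoning

descent⇒formula≡0 : ∀ k n → k ≤ n → (π : Permutation′ n) → ∀ p q →
  n ∸ k + 1 ≤ toℕ p + 1 → toℕ q ≡ suc (toℕ p) → ¬ (toℕ (π ⟨$⟩ʳ p) < toℕ (π ⟨$⟩ʳ q)) →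
  formula k n π ≡ 0
descent⇒formula≡0 k n k≤n π p q p-last q≡p+1 descent =
  trans (cong (product (map (firstFactor k π) (firstPositions k n)) *_) lastProduct≡0)
        (*-zeroʳ (product (map (firstFactor k π) (firstPositions k n))))
  where
  q-after : suc (n ∸ k) ≤ toℕ q
  q-after = subst (suc (n ∸ k) ≤_) (sym q≡p+1) (s≤s (+-cancelʳ-≤ 1 (n ∸ k) (toℕ p) p-last))
  q∈last : q ∈ₗ lastPositions k n
  q∈last = ∈-filter⁺ (λ p → n ∸ k + 1 ≤? toℕ p + 1) (∈-allFin q)
             (subst (_≤ toℕ q + 1) (+-comm 1 (n ∸ k)) (m≤n⇒m≤n+o 1 q-after))
  lastProduct≡0 : product (map (lastFactor k n π) (lastPositions k n)) ≡ 0
  lastProduct≡0 = 0∣⇒≡0 (subst (_∣ _) factor≡0 (∈⇒∣product (∈-map⁺ (lastFactor k n π) q∈last)))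
    where
    factor≡0 : lastFactor k n π q ≡ 0
    factor≡0 = lastFactor≡0 k n π q k≤n q-after (descent⇒a≤1 π p q q≡p+1 descent)

-- Outside S_n^k the formula vanishes: were it nonzero, no descent could occur
-- among the last k spots, i.e. π would lie in S_n^k.
∉Snk⇒formula≡0 : ∀ k n → k ≤ n → (π : Permutation′ n) → ¬ InSnk k n π → formula k n π ≡ 0
∉Snk⇒formula≡0 k n k≤n π π∉ with formula k n π ≟ 0
... | yes formula≡0 = formula≡0
... | no  formula≢0 = contradiction increasing π∉
  where
  increasing : InSnk k n π
  increasing p q p-last q≡p+1 = decidable-stable (_ <? _)
    (formula≢0 ∘ descent⇒formula≡0 k n k≤n π p q p-last q≡p+1)

theorem1p4 : (k n : ℕ) → 1 ≤ k → k ≤ n → (π : Permutation′ n) →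
             (¬ InSnk k n π → IPF k n π ≡ 0) ×
             (InSnk k n π → IPF k n π ≡ formula k n π)
theorem1p4 k n _ k≤n π =
  (λ π∉ → trans (IPF≡formula k n k≤n π) (∉Snk⇒formula≡0 k n k≤n π π∉)) ,
  (λ _ → IPF≡formula k n k≤n π)
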